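{- Let $N$ be a network based on a finite simple connected graph $X$ with capacity function $c : EX \to \{1,2,\dots\}$. Let $\mathcal{C}$ be a nested set of thin cuts, let $B \in \mathcal{C}$, and let $A$ be a thin cut which is not nested with $B$. Then \[\mu(A\cap B, \mathcal{C}) + \mu(A\cap B^*, \mathcal{C}) < \mu(A, \mathcal{C}).\]
   Context: A cut is a subset $A \subseteq VX$ with $A\neq\emptyset, VX$; $A^*$ is its complement, $\delta A$ the set of edges joining $A$ and $A^*$, and $c(A) = \sum_{e\in\delta A} c(e)$. Two subsets $E, F \subseteq VX$ are nested if one of $E\cap F, E^*\cap F, E\cap F^*, E^*\cap F^*$ is empty; a set of cuts is nested if any two of its elements are nested. For an integer $k$, $\mathcal{B}_k$ is the subring of the Boolean ring of all subsets of $VX$ (symmetric difference and intersection) generated by the cuts $C$ with $c(C) \le k$. A cut $A$ is thin if $c(A) = n$ and $A \notin \mathcal{B}_{n-1}$ for some $n$. For a subset $A \subseteq VX$ and a set of cuts $\mathcal{C}$, $\mu(A,\mathcal{C})$ denotes the number of cuts in $\mathcal{C}$ that are not nested with $A$. -}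

module Defs where

open import Data.Nat using (ℕ; zero; suc; _+_; _≤_; _<_; _∸_)
open import Data.Bool using (Bool; true; false; _∧_; not; if_then_else_; _xor_)
open import Data.Fin using (Fin)
open import Data.Fin.Subset using (Subset; _∩_; ∁; ⊥; Nonempty; Empty)
open import Data.Fin.Subset.Properties using (nonempty?)
open import Data.Vec using (lookup; zipWith)
open import Data.Nat.ListAction using (sum)
open import Data.List using (List; []; _∷_; map; allFin; filter; length)
open import Data.List.Relation.Unary.All using (All)
open import Data.List.Relation.Unary.AllPairs using (AllPairs)
open import Data.List.Relation.Unary.Unique.Propositional using (Unique)
open import Data.Product using (_×_)
open import Data.Sum using (_⊎_)
open import Relation.Nullary using (¬_; Dec)
open import Relation.Nullary.Decidable using (¬?; _⊎-dec_)
open import Relation.Binary.PropositionalEquality using (_≡_)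

data Walk {n : ℕ} (adj : Fin n → Fin n → Bool) : Fin n → Fin n → Set where
  stay : ∀ i → Walk adj i i
  step : ∀ i j k → adj i j ≡ true → Walk adj j k → Walk adj i k

-- The capacity of the edge
-- {i,j} is  cap i j  (= cap j i); its values on non-edges are irrelevant.
record Network (n : ℕ) : Set where
  field
    adj       : Fin n → Fin n → Bool
    adj-sym   : ∀ i j → adj i j ≡ adj j i
    adj-irr   : ∀ i → adj i i ≡ false
    connected : ∀ i j → Walk adj i j
    cap       : Fin n → Fin n → ℕ
    cap-sym   : ∀ i j → cap i j ≡ cap j i
    cap-pos   : ∀ i j → adj i j ≡ true → 1 ≤ cap i j

module _ {n : ℕ} (N : Network n) where
  open Network N

  IsCut : Subset n → Set
  IsCut A = Nonempty A × Nonempty (∁ A)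

  -- c(A) = Σ_{e ∈ δA} c(e); each edge {i,j} with i ∈ A, j ∈ A* counted once
  -- via the ordered pair (i , j).
  cutCap : Subset n → ℕ
  cutCap A = sum (map (λ i → sum (map (λ j →
      if lookup A i ∧ not (lookup A j) ∧ adj i j then cap i j else 0)
      (allFin n))) (allFin n))

  -- Symmetric difference (addition in the Boolean ring of subsets of VX).
  _Δ_ : Subset n → Subset n → Subset n
  A Δ B = zipWith _xor_ A B

  data 𝓑 (k : ℕ) : Subset n → Set where
    gen  : ∀ C → IsCut C → cutCap C ≤ k → 𝓑 k C
    zero : 𝓑 k ⊥
    plus : ∀ {A B} → 𝓑 k A → 𝓑 k B → 𝓑 k (A Δ B)
    mult : ∀ {A B} → 𝓑 k A → 𝓑 k B → 𝓑 k (A ∩ B)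

  Thin : Subset n → Set
  Thin A = IsCut A × ¬ 𝓑 (cutCap A ∸ 1) A

Nested : {n : ℕ} → Subset n → Subset n → Set
Nested E F = Empty (E ∩ F) ⊎ Empty (∁ E ∩ F) ⊎ Empty (E ∩ ∁ F) ⊎ Empty (∁ E ∩ ∁ F)

nested? : {n : ℕ} (E F : Subset n) → Dec (Nested E F)
nested? E F = ¬? (nonempty? (E ∩ F)) ⊎-dec ¬? (nonempty? (∁ E ∩ F))
  ⊎-dec ¬? (nonempty? (E ∩ ∁ F)) ⊎-dec ¬? (nonempty? (∁ E ∩ ∁ F))

-- μ(A, 𝒞): number of elements of the (duplicate-free) list 𝒞 not nested with A.
μ : {n : ℕ} → Subset n → List (Subset n) → ℕ
μ A 𝒞 = length (filter (λ C → ¬? (nested? A C)) 𝒞)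

-- Fix C ∈ 𝒞; it is nested with B.  If C is
-- nested with A, it is nested with both A ∩ B and A ∩ B*, because A and B
-- cross; and C is nested with at least one of A ∩ B and A ∩ B*.  So every C
-- counted on the left is counted on the right, and at most once.  Finally
-- B itself is nested with A ∩ B and A ∩ B* but not with A, which makes the
-- inequality strict.
module Submission where

open import Defs
open import Data.Nat using (ℕ; suc; _+_; _<_; _≤_; s≤s; z≤n)
open import Data.Nat.Properties using (+-suc; m≤n⇒m≤1+n)
open import Data.Bool.Properties using (not-involutive)
open import Data.Fin.Subset as Subset using (Subset; _∩_; ∁; _⊆_; Nonempty; Empty)
open import Data.Fin.Subset.Properties
  using (_∈?_; nonempty?; ∉⊥; ⊆-refl; p∩q⊆p; p∩q⊆q; x∈p∩q⁺; x∈p∩q⁻; x∉p⇒x∈∁p; x∈∁p⇒x∉p;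
         ∩-comm; ∩-inverseˡ; ∩-inverseʳ)
open import Data.Vec using ([]; _∷_)
open import Data.List using (List; _∷_; filter; length)
open import Data.List.Properties using (filter-accept; filter-reject)
open import Data.List.Relation.Unary.All as All using (All; _∷_; [])
open import Data.List.Relation.Unary.Any using (here; there)
open import Data.List.Relation.Unary.AllPairs using (AllPairs; _∷_)
open import Data.List.Relation.Unary.Unique.Propositional using (Unique)
open import Data.List.Membership.Propositional using (_∈_)
open import Data.Product using (_×_; _,_)
open import Data.Sum using (_⊎_; inj₁; inj₂; [_,_]′)
open import Data.Empty using (⊥-elim)
open import Function using (_∘_)
open import Relation.Nullary using (¬_; yes; no; contradiction; contraposition)
open import Relation.Nullary.Decidable using (¬?)
open import Relation.Unary using (Pred; Decidable)
open import Relation.Binary.Core using (Rel)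
open import Relation.Binary.Definitions using (Reflexive; Symmetric)
open import Relation.Binary.PropositionalEquality using (_≡_; refl; sym; trans; cong; cong₂; subst)

module _ {a p q r} {X : Set a} {P : Pred X p} {Q : Pred X q} {R : Pred X r}
         (P? : Decidable P) (Q? : Decidable Q) (R? : Decidable R) where

  private
    count : ∀ {s} {S : Pred X s} → Decidable S → List X → ℕ
    count S? = length ∘ filter S?

  Covers : Pred X _
  Covers x = (P x → R x) × (Q x → R x) × (P x → ¬ Q x)

  -- The offset k lets the strict version reuse the same step with k = 1.
  filter-+-≤-∷ : ∀ {k x xs} → Covers x →
    k + (count P? xs + count Q? xs) ≤ count R? xs →
    k + (count P? (x ∷ xs) + count Q? (x ∷ xs)) ≤ count R? (x ∷ xs)
  filter-+-≤-∷ {k} {x} {xs} (P⇒R , Q⇒R , P⇒¬Q) ih with P? x | Q? x | R? x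
  ... | yes Px | yes Qx | _      = contradiction Qx (P⇒¬Q Px)
  ... | yes Px | no _   | no ¬Rx = contradiction (P⇒R Px) ¬Rx
  ... | no _   | yes Qx | no ¬Rx = contradiction (Q⇒R Qx) ¬Rx
  ... | yes _  | no _   | yes _  = subst (_≤ suc (count R? xs)) (sym (+-suc k _)) (s≤s ih)
  ... | no _   | yes _  | yes _  =
    subst (_≤ suc (count R? xs))
          (sym (trans (cong (k +_) (+-suc (count P? xs) _)) (+-suc k _))) (s≤s ih)
  ... | no _   | no _   | yes _  = m≤n⇒m≤1+n ih
  ... | no _   | no _   | no _   = ih

  filter-+-≤ : ∀ {xs} → All Covers xs → count P? xs + count Q? xs ≤ count R? xs
  filter-+-≤ []       = z≤n
  filter-+-≤ (c ∷ cs) = filter-+-≤-∷ {k = 0} c (filter-+-≤ cs)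

  filter-+-< : ∀ {xs b} → All Covers xs → b ∈ xs → ¬ P b → ¬ Q b → R b →
    count P? xs + count Q? xs < count R? xs
  filter-+-< {b ∷ xs} (_ ∷ cs) (here refl) ¬Pb ¬Qb Rb
    rewrite filter-reject P? {xs = xs} ¬Pb | filter-reject Q? {xs = xs} ¬Qb | filter-accept R? {xs = xs} Rb
    = s≤s (filter-+-≤ cs)
  filter-+-< (c ∷ cs) (there b∈xs) ¬Pb ¬Qb Rb = filter-+-≤-∷ {k = 1} c (filter-+-< cs b∈xs ¬Pb ¬Qb Rb)

AllPairs-lookup : ∀ {a ℓ} {A : Set a} {R : Rel A ℓ} → Reflexive R → Symmetric R →
  ∀ {xs x y} → AllPairs R xs → x ∈ xs → y ∈ xs → R x y
AllPairs-lookup refl′ sym′ (_  ∷ _)   (here refl) (here refl) = refl′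
AllPairs-lookup refl′ sym′ (Rx ∷ _)   (here refl) (there y∈)  = All.lookup Rx y∈
AllPairs-lookup refl′ sym′ (Rx ∷ _)   (there x∈)  (here refl) = sym′ (All.lookup Rx x∈)
AllPairs-lookup refl′ sym′ (_  ∷ Rxs) (there x∈)  (there y∈)  = AllPairs-lookup refl′ sym′ Rxs x∈ y∈

pattern disjoint  e = inj₁ e
pattern contains  e = inj₂ (inj₁ e)
pattern contained e = inj₂ (inj₂ (inj₁ e))
pattern covering  e = inj₂ (inj₂ (inj₂ e))

∁-involutive : ∀ {n} (E : Subset n) → ∁ (∁ E) ≡ E
∁-involutive []      = refl
∁-involutive (x ∷ E) = cong₂ _∷_ (not-involutive x) (∁-involutive E)

module _ {n : ℕ} where

  private variable
    A B C E F G : Subset n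

  Empty-∩-antimonoˡ : E ⊆ F → Empty (F ∩ G) → Empty (E ∩ G)
  Empty-∩-antimonoˡ E⊆F F∩G=∅ (x , x∈E∩G) with x∈p∩q⁻ _ _ x∈E∩G
  ... | x∈E , x∈G = F∩G=∅ (x , x∈p∩q⁺ (E⊆F x∈E , x∈G))

  ¬Empty⇒Nonempty : ¬ Empty E → Nonempty E
  ¬Empty⇒Nonempty {E = E} ¬E=∅ with nonempty? E
  ... | yes ne = ne
  ... | no E=∅ = contradiction E=∅ ¬E=∅

  Empty-∩∁ : (E : Subset n) → Empty (E ∩ ∁ E)
  Empty-∩∁ E (x , x∈) = ∉⊥ (subst (x Subset.∈_) (∩-inverseʳ E) x∈)

  Empty-∁∩ : (E : Subset n) → Empty (∁ E ∩ E)
  Empty-∁∩ E (x , x∈) = ∉⊥ (subst (x Subset.∈_) (∩-inverseˡ E) x∈)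

  Empty-∩-split : Empty (E ∩ G) → Empty (F ∩ ∁ G) → Empty (E ∩ F)
  Empty-∩-split {G = G} E∩G=∅ F∩∁G=∅ (x , x∈E∩F) with x∈p∩q⁻ _ _ x∈E∩F | x ∈? G
  ... | x∈E , _   | yes x∈G = E∩G=∅ (x , x∈p∩q⁺ (x∈E , x∈G))
  ... | _   , x∈F | no  x∉G = F∩∁G=∅ (x , x∈p∩q⁺ (x∈F , x∉p⇒x∈∁p x∉G))

  Empty-∁[∩]∩ : Empty (∁ A ∩ C) → Empty (∁ B ∩ C) → Empty (∁ (A ∩ B) ∩ C)
  Empty-∁[∩]∩ {A = A} ∁A∩C=∅ ∁B∩C=∅ (x , x∈) with x∈p∩q⁻ _ _ x∈ | x ∈? A
  ... | _     , x∈C | no  x∉A = ∁A∩C=∅ (x , x∈p∩q⁺ (x∉p⇒x∈∁p x∉A , x∈C))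
  ... | x∉A∩B , x∈C | yes x∈A = ∁B∩C=∅ (x , x∈p∩q⁺ (x∉p⇒x∈∁p x∉B , x∈C))
    where x∉B = λ x∈B → x∈∁p⇒x∉p x∉A∩B (x∈p∩q⁺ (x∈A , x∈B))

  Nested-sym : Nested E F → Nested F E
  Nested-sym {E} {F} (disjoint  e) = disjoint  (subst Empty (∩-comm E F) e)
  Nested-sym         (contains  e) = contained (subst Empty (∩-comm _ _) e)
  Nested-sym         (contained e) = contains  (subst Empty (∩-comm _ _) e)
  Nested-sym {E} {F} (covering  e) = covering  (subst Empty (∩-comm (∁ E) (∁ F)) e)

  Nested-∁ˡ : Nested E F → Nested (∁ E) F
  Nested-∁ˡ {E} {F} (disjoint  e) = contains (subst (λ D → Empty (D ∩ F)) (sym (∁-involutive E)) e)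
  Nested-∁ˡ         (contains  e) = disjoint e
  Nested-∁ˡ {E} {F} (contained e) = covering (subst (λ D → Empty (D ∩ ∁ F)) (sym (∁-involutive E)) e)
  Nested-∁ˡ         (covering  e) = contained e

  ⊆⇒Nested : E ⊆ F → Nested E F
  ⊆⇒Nested {F = F} E⊆F = contained (Empty-∩-antimonoˡ E⊆F (Empty-∩∁ F))

  ⊆∁⇒Nested : E ⊆ ∁ F → Nested E F
  ⊆∁⇒Nested {F = F} E⊆∁F = disjoint (Empty-∩-antimonoˡ E⊆∁F (Empty-∁∩ F))

  Nested-refl : Reflexive (Nested {n})
  Nested-refl = ⊆⇒Nested ⊆-refl

  -- The two mixed cases would force A* ∩ B* = ∅.
  Nested-∩ : Nonempty (∁ A ∩ ∁ B) → Nested A C → Nested B C → Nested (A ∩ B) C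
  Nested-∩ {A} {B} _ (disjoint  e) _ = disjoint  (Empty-∩-antimonoˡ (p∩q⊆p A B) e)
  Nested-∩ {A} {B} _ (contained e) _ = contained (Empty-∩-antimonoˡ (p∩q⊆p A B) e)
  Nested-∩ {A} {B} _ _ (disjoint  e) = disjoint  (Empty-∩-antimonoˡ (p∩q⊆q A B) e)
  Nested-∩ {A} {B} _ _ (contained e) = contained (Empty-∩-antimonoˡ (p∩q⊆q A B) e)
  Nested-∩ _ (contains eA) (contains eB) = contains (Empty-∁[∩]∩ eA eB)
  Nested-∩ _ (covering eA) (covering eB) = covering (Empty-∁[∩]∩ eA eB)
  Nested-∩ (x , x∈) (contains eA) (covering eB) = ⊥-elim (Empty-∩-split eA eB (x , x∈))
  Nested-∩ (x , x∈) (covering eA) (contains eB) with x∈p∩q⁻ _ _ x∈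
  ... | x∈∁A , x∈∁B = ⊥-elim (Empty-∩-split eB eA (x , x∈p∩q⁺ (x∈∁B , x∈∁A)))

  Nested-∩∁ : Nonempty (∁ A ∩ B) → Nested A C → Nested B C → Nested (A ∩ ∁ B) C
  Nested-∩∁ {A} {B} w AC BC =
    Nested-∩ (subst (λ D → Nonempty (∁ A ∩ D)) (sym (∁-involutive B)) w) AC (Nested-∁ˡ BC)

  Nested-∩⊎Nested-∩∁ : Nested B C → Nested (A ∩ B) C ⊎ Nested (A ∩ ∁ B) C
  Nested-∩⊎Nested-∩∁ {B} {A = A} (disjoint  e) = inj₁ (disjoint  (Empty-∩-antimonoˡ (p∩q⊆q A B) e))
  Nested-∩⊎Nested-∩∁ {B} {A = A} (contains  e) = inj₂ (disjoint  (Empty-∩-antimonoˡ (p∩q⊆q A (∁ B)) e))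
  Nested-∩⊎Nested-∩∁ {B} {A = A} (contained e) = inj₁ (contained (Empty-∩-antimonoˡ (p∩q⊆q A B) e))
  Nested-∩⊎Nested-∩∁ {B} {A = A} (covering  e) = inj₂ (contained (Empty-∩-antimonoˡ (p∩q⊆q A (∁ B)) e))

mainTheorem4 : {n : ℕ} (N : Network n) (𝒞 : List (Subset n)) →
    Unique 𝒞 → All (Thin N) 𝒞 → AllPairs Nested 𝒞 →
    (B : Subset n) → B ∈ 𝒞 →
    (A : Subset n) → Thin N A → ¬ Nested A B →
    μ (A ∩ B) 𝒞 + μ (A ∩ ∁ B) 𝒞 < μ A 𝒞
mainTheorem4 {n} _ 𝒞 _ _ 𝒞-nested B B∈𝒞 A _ A⋔B =
  filter-+-< (crosses? (A ∩ B)) (crosses? (A ∩ ∁ B)) (crosses? A) (All.tabulate covers) B∈𝒞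
    (λ ¬N → ¬N (⊆⇒Nested (p∩q⊆q A B))) (λ ¬N → ¬N (⊆∁⇒Nested (p∩q⊆q A (∁ B)))) A⋔B
  where
  crosses? : (E : Subset n) → Decidable (λ C → ¬ Nested E C)
  crosses? E C = ¬? (nested? E C)

  covers : ∀ {C} → C ∈ 𝒞 → Covers (crosses? (A ∩ B)) (crosses? (A ∩ ∁ B)) (crosses? A) C
  covers {C} C∈𝒞 =
      contraposition (λ AC → Nested-∩ (¬Empty⇒Nonempty (A⋔B ∘ covering)) AC BC)
    , contraposition (λ AC → Nested-∩∁ (¬Empty⇒Nonempty (A⋔B ∘ contains)) AC BC)
    , λ ¬N₁ ¬N₂ → [ ¬N₁ , ¬N₂ ]′ (Nested-∩⊎Nested-∩∁ BC)
    where
    BC : Nested B C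
    BC = AllPairs-lookup Nested-refl Nested-sym 𝒞-nested B∈𝒞 C∈𝒞
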